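{- Let $G'$ be a 2-terminal directed graph and $S$ a set of edges of $G'$. If $S$ is parallel (respectively, serial) in $G'$, then after any sequence of d-embedding operations applied to $G'$, the set $S$ is still parallel (respectively, serial) in the resulting graph. In particular, if $G'$ is d-embedded in $G$ then $PW(G)\geq PW(G')$ and $SPW(G)\geq SPW(G')$.
   Context: A 2-terminal directed graph $\langle V,E,s,t\rangle$ is a directed multigraph without self-loops with distinguished vertices $s,t$ such that every vertex and edge lies on at least one simple directed $s$–$t$ path. A cut is $C\subseteq E$ such that no directed $s$–$t$ path uses only edges of $E\setminus C$; minimal if no proper subset is a cut. $S\subseteq E$ is parallel if contained in a minimal cut; serial if some simple directed $s$–$t$ path contains all its edges. $PW(G)$ is the maximum size of a parallel set; $SPW(G)$ is the maximum size of a set both serial and parallel. d-embedding operations: (Addition) add a new edge $(a,b)$ between existing vertices such that there is no directed path from $b$ to $a$; (Forward split) replace a vertex $a\neq t$ by vertices $a,b$ and a new edge $(a,b)$, $a$ retaining all incoming edges and the outgoing edges being distributed between $a$ and $b$ with $b$ retaining at least one; (Backward split) replace a vertex $b\neq s$ by vertices $a,b$ and a new edge $(a,b)$, $b$ retaining all outgoing edges and the incoming edges being distributed with $a$ retaining at least one. $G'$ is d-embedded in $G$ if $G$ is isomorphic to a graph obtained from $G'$ by a finite (possibly empty) sequence of such operations. -}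

module Defs where

open import Data.Nat using (ℕ; zero; suc; _≤_)
open import Data.Fin using (Fin; zero; suc; inject₁; fromℕ)
open import Data.Fin.Subset using (Subset; _∈_; _∉_; _⊆_; _⊂_; ∣_∣; outside)
open import Data.Vec using (_∷ʳ_; lookup)
open import Data.List using (List; []; _∷_)
open import Data.List.Membership.Propositional using () renaming (_∈_ to _∈ₗ_)
open import Data.List.Relation.Unary.All using (All)
open import Data.List.Relation.Unary.Unique.Propositional using (Unique)
open import Data.Product using (Σ; ∃; _×_; _,_)
open import Data.Bool using (if_then_else_)
open import Relation.Nullary using (¬_; does)
open import Relation.Binary.PropositionalEquality using (_≡_; _≢_)
open import Function.Bundles using (_↔_; Inverse)

record Graph : Set where
  field
    nV nE : ℕ
    src tgt : Fin nE → Fin nV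
    s t : Fin nV
open Graph public

-- Directed walks (directed paths, vertices possibly repeated) from u to v.
data Path (G : Graph) : Fin (nV G) → Fin (nV G) → Set where
  []  : ∀ {u} → Path G u u
  _∷_ : ∀ {u v} (e : Fin (nE G)) → {src G e ≡ u} → Path G (tgt G e) v → Path G u v

edges : ∀ {G u v} → Path G u v → List (Fin (nE G))
edges []      = []
edges (e ∷ p) = e ∷ edges p

vertices : ∀ {G u v} → Path G u v → List (Fin (nV G))
vertices {u = u} []      = u ∷ []
vertices {u = u} (e ∷ p) = u ∷ vertices p

Simple : ∀ {G u v} → Path G u v → Set
Simple p = Unique (vertices p)

record TwoTerminal (G : Graph) : Set where
  field
    noSelfLoop : ∀ e → src G e ≢ tgt G e
    vertexOnPath : ∀ v → Σ (Path G (s G) (t G)) λ p → Simple p × v ∈ₗ vertices p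
    edgeOnPath   : ∀ e → Σ (Path G (s G) (t G)) λ p → Simple p × e ∈ₗ edges p

IsCut : (G : Graph) → Subset (nE G) → Set
IsCut G C = ∀ (p : Path G (s G) (t G)) → ¬ All (λ e → e ∉ C) (edges p)

IsMinimalCut : (G : Graph) → Subset (nE G) → Set
IsMinimalCut G C = IsCut G C × (∀ C' → C' ⊂ C → ¬ IsCut G C')

Parallel : (G : Graph) → Subset (nE G) → Set
Parallel G S = Σ (Subset (nE G)) λ C → IsMinimalCut G C × S ⊆ C

Serial : (G : Graph) → Subset (nE G) → Set
Serial G S = Σ (Path G (s G) (t G)) λ p → Simple p × (∀ e → e ∈ S → e ∈ₗ edges p)

IsPW : Graph → ℕ → Set
IsPW G k = (Σ (Subset (nE G)) λ S → Parallel G S × ∣ S ∣ ≡ k)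
         × (∀ S → Parallel G S → ∣ S ∣ ≤ k)

IsSPW : Graph → ℕ → Set
IsSPW G k = (Σ (Subset (nE G)) λ S → Serial G S × Parallel G S × ∣ S ∣ ≡ k)
          × (∀ S → Serial G S → Parallel G S → ∣ S ∣ ≤ k)

-- d-embedding operations.  In every operation the old vertices/edges are
-- embedded via inject₁; the new vertex / new edge is the last one (fromℕ).

data Op (G : Graph) : Set where
  addition : (a b : Fin (nV G)) → ¬ Path G b a → Op G
  -- Forward split of a ≠ t: the outgoing edges of a in M move to the new
  -- vertex b (M nonempty); new edge (a,b)
  fsplit : (a : Fin (nV G)) → a ≢ t G → (M : Subset (nE G)) →
           (∀ e → e ∈ M → src G e ≡ a) → (∃ λ e → e ∈ M) → Op G
  -- Backward split of b ≠ s: the incoming edges of b in M move to the new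
  -- vertex a (M nonempty); new edge (a,b)
  bsplit : (b : Fin (nV G)) → b ≢ s G → (M : Subset (nE G)) →
           (∀ e → e ∈ M → tgt G e ≡ b) → (∃ λ e → e ∈ M) → Op G

ext : ∀ {m} {A : Set} → (Fin m → A) → A → Fin (suc m) → A
ext {zero}  f x zero    = x
ext {suc m} f x zero    = f zero
ext {suc m} f x (suc i) = ext (λ j → f (suc j)) x i

apply : (G : Graph) → Op G → Graph
apply G (addition a b _) = record
  { nV = nV G ; nE = suc (nE G)
  ; src = ext (src G) a ; tgt = ext (tgt G) b
  ; s = s G ; t = t G }
apply G (fsplit a _ M _ _) = record
  { nV = suc (nV G) ; nE = suc (nE G)
  ; src = ext (λ e → if lookup M e then fromℕ (nV G) else inject₁ (src G e))
              (inject₁ a)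
  ; tgt = ext (λ e → inject₁ (tgt G e)) (fromℕ (nV G))
  ; s = inject₁ (s G) ; t = inject₁ (t G) }
apply G (bsplit b _ M _ _) = record
  { nV = suc (nV G) ; nE = suc (nE G)
  ; src = ext (λ e → inject₁ (src G e)) (fromℕ (nV G))
  ; tgt = ext (λ e → if lookup M e then fromℕ (nV G) else inject₁ (tgt G e))
              (inject₁ b)
  ; s = inject₁ (s G) ; t = inject₁ (t G) }

data Steps : Graph → Graph → Set where
  done : ∀ {G} → Steps G G
  step : ∀ {G H} (o : Op G) → Steps (apply G o) H → Steps G H

transport : ∀ {G H} → Steps G H → Subset (nE G) → Subset (nE H)
transport done       S = S
transport (step (addition _ _ _) r)   S = transport r (S ∷ʳ outside)
transport (step (fsplit _ _ _ _ _) r) S = transport r (S ∷ʳ outside)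
transport (step (bsplit _ _ _ _ _) r) S = transport r (S ∷ʳ outside)

record Iso (H G : Graph) : Set where
  field
    φV : Fin (nV H) ↔ Fin (nV G)
    φE : Fin (nE H) ↔ Fin (nE G)
    srcPres : ∀ e → src G (Inverse.to φE e) ≡ Inverse.to φV (src H e)
    tgtPres : ∀ e → tgt G (Inverse.to φE e) ≡ Inverse.to φV (tgt H e)
    sPres : Inverse.to φV (s H) ≡ s G
    tPres : Inverse.to φV (t H) ≡ t G

DEmbedded : Graph → Graph → Set
DEmbedded G' G = Σ Graph λ H → Steps G' H × Iso H G

-- Each operation embeds the edges of G into those of H, and s–t walks move both ways: a walk
-- of G lifts to a walk of H through the same old edges, simple walks staying simple, and for
-- splits and isomorphisms a walk of H projects to one of G by contracting the new edge. Lifting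
-- carries serial sets over. Projecting shows that the image of a cut is a cut, and lifting that
-- it stays minimal: a cut of H inside the image of C minus one edge would pull back to a cut of
-- G inside C minus that edge. An added edge (a, b) cannot be contracted, and there a case split
-- on reachability decides whether a minimal cut of G must absorb it. Edge sets keep their size along the operations and cannot shrink along an
-- isomorphism, so PW and SPW can only grow.

module Submission where

open import Defs
open import Data.Nat using (zero; suc; _≤_; z≤n; s≤s)
open import Data.Nat.Properties using (≤-trans; ≤-reflexive)
open import Data.Bool using (if_then_else_)
open import Data.Bool.Properties using (¬-not)
open import Data.Empty using (⊥-elim)
open import Data.Fin using (Fin; zero; suc; inject₁; fromℕ; _≟_)
open import Data.Fin.Properties using (any?; suc-injective; 0≢1+n; inject₁-injective; fromℕ≢inject₁)
open import Data.Fin.Relation.Unary.Top using (view; ‵fromℕ; ‵inject₁)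
open import Data.Fin.Subset using (Subset; _∈_; _∉_; _⊆_; _⊃_; _∪_; _-_; ⁅_⁆; ∣_∣; inside; outside)
open import Data.Fin.Subset.Properties
  using (_∈?_; x∈⁅x⁆; x∈⁅y⁆⇒x≡y; p⊆p∪q; q⊆p∪q; x∈p∪q⁻; p─q⊆p; x∈p∧x≢y⇒x∈p-y; x∈p⇒p-x⊂p; x∈p⇒∣p-x∣<∣p∣)
open import Data.Fin.Subset.Induction using (⊃-wellFounded; Acc; acc)
open import Data.Vec using ([]; _∷_; _∷ʳ_; lookup; tabulate; here; there)
open import Data.Vec.Properties using (lookup∘tabulate; []=⇒lookup; lookup⇒[]=)
open import Data.List using (List; []; _∷_; _++_; map; reverse; reverseAcc; drop)
open import Data.List.Membership.Propositional using () renaming (_∈_ to _∈ₗ_; _∉_ to _∉ₗ_)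
open import Data.List.Membership.Propositional.Properties using (∈-map⁺; ∈-map⁻)
open import Data.List.Relation.Unary.Any using (here; there)
open import Data.List.Relation.Unary.Any.Properties using (reverse⁺; reverse⁻)
open import Data.List.Relation.Unary.All as All using (All; []; _∷_)
open import Data.List.Relation.Unary.All.Properties using (++⁺; map⁺)
open import Data.List.Relation.Unary.AllPairs using ([]; _∷_)
open import Data.List.Relation.Unary.Unique.Propositional using (Unique)
open import Data.List.Relation.Unary.Unique.Propositional.Properties using (Unique[x∷xs]⇒x∉xs)
import Data.List.Relation.Unary.Unique.Propositional.Properties as Unique
import Data.List.Relation.Binary.Permutation.Setoid as Permutation
import Data.List.Relation.Binary.Permutation.Setoid.Properties as PermutationProperties
open import Data.Product using (Σ; ∃; _×_; _,_; proj₁; proj₂; uncurry)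
open import Data.Sum as Sum using (_⊎_; inj₁; inj₂)
open import Function using (_∘_; id)
open import Function.Bundles using (Inverse; Injection)
open import Function.Definitions using (Injective)
open import Function.Properties.Inverse using (↔⇒↣)
open import Relation.Nullary using (¬_; Dec; yes; no)
open import Relation.Nullary.Decidable using (_×-dec_; ¬?; decidable-stable)
open import Relation.Binary.PropositionalEquality
open import Relation.Binary.Construct.Closure.ReflexiveTransitive using (Star; ε; _◅_; _◅◅_)

ext-inject₁ : ∀ {m} {A : Set} (f : Fin m → A) x i → ext f x (inject₁ i) ≡ f i
ext-inject₁ {suc m} f x zero    = refl
ext-inject₁ {suc m} f x (suc i) = ext-inject₁ (f ∘ suc) x i

ext-fromℕ : ∀ {m} {A : Set} (f : Fin m → A) x → ext f x (fromℕ m) ≡ x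
ext-fromℕ {zero}  f x = refl
ext-fromℕ {suc m} f x = ext-fromℕ (f ∘ suc) x

∈-∷ʳ⁺ : ∀ {n} {p : Subset n} {i} b → i ∈ p → inject₁ i ∈ p ∷ʳ b
∈-∷ʳ⁺ b here        = here
∈-∷ʳ⁺ b (there i∈p) = there (∈-∷ʳ⁺ b i∈p)

∈-∷ʳ⁻ : ∀ {n} {p : Subset n} {i} b → inject₁ i ∈ p ∷ʳ b → i ∈ p
∈-∷ʳ⁻ {p = _ ∷ _} {zero}  b here        = here
∈-∷ʳ⁻ {p = _ ∷ _} {suc i} b (there i∈p) = there (∈-∷ʳ⁻ b i∈p)

fromℕ∈p∷ʳinside : ∀ {n} (p : Subset n) → fromℕ n ∈ p ∷ʳ inside
fromℕ∈p∷ʳinside []      = here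
fromℕ∈p∷ʳinside (_ ∷ p) = there (fromℕ∈p∷ʳinside p)

fromℕ∉p∷ʳoutside : ∀ {n} (p : Subset n) → fromℕ n ∉ p ∷ʳ outside
fromℕ∉p∷ʳoutside []      ()
fromℕ∉p∷ʳoutside (_ ∷ p) (there x∈) = fromℕ∉p∷ʳoutside p x∈

∈-∷ʳoutside⁻ : ∀ {n} {p : Subset n} {x} → x ∈ p ∷ʳ outside → ∃ λ i → x ≡ inject₁ i × i ∈ p
∈-∷ʳoutside⁻ {p = p} {x} x∈ with view x
... | ‵fromℕ     = ⊥-elim (fromℕ∉p∷ʳoutside p x∈)
... | ‵inject₁ i = i , refl , ∈-∷ʳ⁻ outside x∈

∷ʳ-⊆ : ∀ {n} {p q : Subset n} b → p ⊆ q → p ∷ʳ outside ⊆ q ∷ʳ b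
∷ʳ-⊆ b p⊆q x∈ with ∈-∷ʳoutside⁻ x∈
... | _ , refl , i∈p = ∈-∷ʳ⁺ b (p⊆q i∈p)

∣p∷ʳoutside∣≡∣p∣ : ∀ {n} (p : Subset n) → ∣ p ∷ʳ outside ∣ ≡ ∣ p ∣
∣p∷ʳoutside∣≡∣p∣ []            = refl
∣p∷ʳoutside∣≡∣p∣ (inside  ∷ p) = cong suc (∣p∷ʳoutside∣≡∣p∣ p)
∣p∷ʳoutside∣≡∣p∣ (outside ∷ p) = ∣p∷ʳoutside∣≡∣p∣ p

x∉p-x : ∀ {n} (p : Subset n) x → x ∉ p - x
x∉p-x (_ ∷ p) zero    ()
x∉p-x (_ ∷ p) (suc x) (there x∈) = x∉p-x p x x∈

∣p∣≤∣q∣-by-injection : ∀ {m n} {p : Subset m} {q : Subset n} (f : Fin m → Fin n) →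
                       Injective _≡_ _≡_ f → (∀ {i} → i ∈ p → f i ∈ q) → ∣ p ∣ ≤ ∣ q ∣
∣p∣≤∣q∣-by-injection {p = []}          f f-inj f[p]⊆q = z≤n
∣p∣≤∣q∣-by-injection {p = outside ∷ p} f f-inj f[p]⊆q =
  ∣p∣≤∣q∣-by-injection (f ∘ suc) (suc-injective ∘ f-inj) (f[p]⊆q ∘ there)
∣p∣≤∣q∣-by-injection {p = inside  ∷ p} {q} f f-inj f[p]⊆q =
  ≤-trans (s≤s (∣p∣≤∣q∣-by-injection (f ∘ suc) (suc-injective ∘ f-inj) f[p]⊆q-f0))
          (x∈p⇒∣p-x∣<∣p∣ (f[p]⊆q here))
  where
  f[p]⊆q-f0 : ∀ {i} → i ∈ p → f (suc i) ∈ q - f zero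
  f[p]⊆q-f0 i∈p = x∈p∧x≢y⇒x∈p-y (f[p]⊆q (there i∈p)) (0≢1+n ∘ sym ∘ f-inj)

Unique-reverse : ∀ {A : Set} {xs : List A} → Unique xs → Unique (reverse xs)
Unique-reverse {A} {xs} = Unique-resp-↭ (↭-sym (↭-reverse xs))
  where
  open Permutation (setoid A) using (↭-sym)
  open PermutationProperties (setoid A) using (Unique-resp-↭; ↭-reverse)

Unique-∷ : ∀ {A : Set} {x : A} {xs} → x ∉ₗ xs → Unique xs → Unique (x ∷ xs)
Unique-∷ x∉xs u = All.tabulate (λ y∈xs x≡y → x∉xs (subst (_∈ₗ _) (sym x≡y) y∈xs)) ∷ u

Avoids : ∀ {G u v} → Subset (nE G) → Path G u v → Set
Avoids C p = All (_∉ C) (edges p)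

vertices-head : ∀ {G u v} (p : Path G u v) → u ∷ drop 1 (vertices p) ≡ vertices p
vertices-head []      = refl
vertices-head (_ ∷ _) = refl

module _ {G : Graph} where

  _++ᵖ_ : ∀ {u v w} → Path G u v → Path G v w → Path G u w
  []             ++ᵖ q = q
  (_∷_ e {eq} p) ++ᵖ q = _∷_ e {eq} (p ++ᵖ q)

  edges-++ᵖ : ∀ {u v w} (p : Path G u v) (q : Path G v w) → edges (p ++ᵖ q) ≡ edges p ++ edges q
  edges-++ᵖ []      q = refl
  edges-++ᵖ (e ∷ p) q = cong (e ∷_) (edges-++ᵖ p q)

  cut-mono : ∀ {C D} → C ⊆ D → IsCut G C → IsCut G D
  cut-mono C⊆D cut p avoidsD = cut p (All.map (_∘ C⊆D) avoidsD)

  minimal⇒¬cut-minus : ∀ {C x} → IsMinimalCut G C → x ∈ C → ¬ IsCut G (C - x)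
  minimal⇒¬cut-minus (_ , minimal) x∈C = minimal _ (x∈p⇒p-x⊂p x∈C)

  ¬cut-minus⇒minimal : ∀ {K} → IsCut G K → (∀ {x} → x ∈ K → ¬ IsCut G (K - x)) → IsMinimalCut G K
  ¬cut-minus⇒minimal cut removal = cut , λ where
    C′ (C′⊆K , x , x∈K , x∉C′) → removal x∈K ∘ cut-mono λ y∈C′ →
      x∈p∧x≢y⇒x∈p-y (C′⊆K y∈C′) λ where refl → x∉C′ y∈C′

reverseGraph : Graph → Graph
reverseGraph G = record G { src = tgt G ; tgt = src G ; s = t G ; t = s G }

module _ {G : Graph} where

  reverseOnto : ∀ {u v w} → Path G u v → Path (reverseGraph G) u w → Path (reverseGraph G) v w
  reverseOnto []               q = q
  reverseOnto (_∷_ e {refl} p) q = reverseOnto p (_∷_ e {refl} q)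

  reversePath : ∀ {u v} → Path G u v → Path (reverseGraph G) v u
  reversePath p = reverseOnto p []

  edges-reverseOnto : ∀ {u v w} (p : Path G u v) (q : Path (reverseGraph G) u w) →
                      edges (reverseOnto p q) ≡ reverseAcc (edges q) (edges p)
  edges-reverseOnto []               q = refl
  edges-reverseOnto (_∷_ e {refl} p) q = edges-reverseOnto p (_∷_ e {refl} q)

  vertices-reverseOnto : ∀ {u v w} (p : Path G u v) (q : Path (reverseGraph G) u w) →
                         vertices (reverseOnto p q) ≡ reverseAcc (drop 1 (vertices q)) (vertices p)
  vertices-reverseOnto []               q = sym (vertices-head q)
  vertices-reverseOnto (_∷_ e {refl} p) q =
    trans (vertices-reverseOnto p (_∷_ e {refl} q))
          (cong (λ acc → reverseAcc acc (vertices p)) (sym (vertices-head q)))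

  reversePath-simple : ∀ {u v} {p : Path G u v} → Simple p → Simple (reversePath p)
  reversePath-simple {p = p} = subst Unique (sym (vertices-reverseOnto p [])) ∘ Unique-reverse

  ∈-reversePath⁺ : ∀ {u v e} {p : Path G u v} → e ∈ₗ edges p → e ∈ₗ edges (reversePath p)
  ∈-reversePath⁺ {p = p} = subst (_ ∈ₗ_) (sym (edges-reverseOnto p [])) ∘ reverse⁺

  ∈-reversePath⁻ : ∀ {u v e} {p : Path G u v} → e ∈ₗ edges (reversePath p) → e ∈ₗ edges p
  ∈-reversePath⁻ {p = p} = reverse⁻ ∘ subst (_ ∈ₗ_) (edges-reverseOnto p [])

cut-reverse : ∀ {G C} → IsCut G C → IsCut (reverseGraph G) C
cut-reverse cut p avoids = cut (reversePath p) (All.tabulate (All.lookup avoids ∘ ∈-reversePath⁻))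

module _ {G : Graph} where

  parallel-reverse : ∀ {S} → Parallel G S → Parallel (reverseGraph G) S
  parallel-reverse (C , (cut , minimal) , S⊆C) =
    C , (cut-reverse cut , λ C′ C′⊂C → minimal C′ C′⊂C ∘ cut-reverse) , S⊆C

  serial-reverse : ∀ {S} → Serial G S → Serial (reverseGraph G) S
  serial-reverse (p , simple , S⊆p) =
    reversePath p , reversePath-simple simple , λ e e∈S → ∈-reversePath⁺ (S⊆p e e∈S)

module _ {n} {R : Fin n → Fin n → Set} (R? : ∀ x y → Dec (R x y)) where

  private
    Closed : Subset n → Set
    Closed X = ∀ {x y} → x ∈ X → R x y → y ∈ X

    closed-star : ∀ {X x y} → Closed X → x ∈ X → Star R x y → y ∈ X
    closed-star closed x∈X ε        = x∈X
    closed-star closed x∈X (r ◅ rs) = closed-star closed (closed x∈X r) rs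

    closure : ∀ {x} X → Acc _⊃_ X → x ∈ X → (∀ {y} → y ∈ X → Star R x y) →
              Σ (Subset n) λ Y → x ∈ Y × (∀ {y} → y ∈ Y → Star R x y) × Closed Y
    closure X (acc rec) x∈X reached
      with any? (λ y → any? λ z → (y ∈? X) ×-dec (R? y z ×-dec ¬? (z ∈? X)))
    ... | no ¬escape =
      X , x∈X , reached ,
      λ {y} {z} y∈X r → decidable-stable (z ∈? X) λ z∉X → ¬escape (y , z , y∈X , r , z∉X)
    ... | yes (y , z , y∈X , r , z∉X) =
      closure (X ∪ ⁅ z ⁆) (rec (p⊆p∪q ⁅ z ⁆ , z , q⊆p∪q X ⁅ z ⁆ (x∈⁅x⁆ z) , z∉X))
              (p⊆p∪q ⁅ z ⁆ x∈X) reached′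
      where
      reached′ : ∀ {w} → w ∈ X ∪ ⁅ z ⁆ → Star R _ w
      reached′ w∈ with x∈p∪q⁻ X ⁅ z ⁆ w∈
      ... | inj₁ w∈X = reached w∈X
      ... | inj₂ w∈z rewrite x∈⁅y⁆⇒x≡y z w∈z = reached y∈X ◅◅ (r ◅ ε)

  star? : ∀ x y → Dec (Star R x y)
  star? x y
    with closure ⁅ x ⁆ (⊃-wellFounded _) (x∈⁅x⁆ x) (λ y∈ → subst (Star R x) (sym (x∈⁅y⁆⇒x≡y x y∈)) ε)
  ... | Y , x∈Y , reached , closed with y ∈? Y
  ...   | yes y∈Y = yes (reached y∈Y)
  ...   | no  y∉Y = no (y∉Y ∘ closed-star closed x∈Y)

Link : (G : Graph) → Subset (nE G) → Fin (nV G) → Fin (nV G) → Set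
Link G C u v = ∃ λ e → e ∉ C × src G e ≡ u × tgt G e ≡ v

link? : ∀ G C u v → Dec (Link G C u v)
link? G C u v = any? λ e → ¬? (e ∈? C) ×-dec (src G e ≟ u ×-dec tgt G e ≟ v)

walk-avoiding : ∀ {G C u v} → Star (Link G C) u v → Σ (Path G u v) (Avoids C)
walk-avoiding ε = [] , []
walk-avoiding ((e , e∉C , refl , refl) ◅ r) with walk-avoiding r
... | p , avoids = _∷_ e {refl} p , e∉C ∷ avoids

record IsImage {m n} (ι : Fin m → Fin n) (img : Subset m → Subset n) : Set where
  field
    image⁺ : ∀ {S e} → e ∈ S → ι e ∈ img S
    image⁻ : ∀ {S x} → x ∈ img S → ∃ λ e → x ≡ ι e × e ∈ S

  image-⊆ : ∀ {S T} → S ⊆ T → img S ⊆ img T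
  image-⊆ S⊆T x∈ with image⁻ x∈
  ... | _ , refl , e∈S = image⁺ (S⊆T e∈S)

∷ʳ-image : ∀ {n} → IsImage (inject₁ {n}) (_∷ʳ outside)
∷ʳ-image = record { image⁺ = ∈-∷ʳ⁺ outside ; image⁻ = ∈-∷ʳoutside⁻ }

record Lifting (G H : Graph) (ι : Fin (nE G) → Fin (nE H)) : Set where
  field
    lift        : Path G (s G) (t G) → Path H (s H) (t H)
    lift-simple : ∀ {p} → Simple p → Simple (lift p)
    ∈-lift⁺     : ∀ {p e} → e ∈ₗ edges p → ι e ∈ₗ edges (lift p)
    ∈-lift⁻     : ∀ {p e} → ι e ∈ₗ edges (lift p) → e ∈ₗ edges p

record Projection (H G : Graph) (ι : Fin (nE G) → Fin (nE H)) : Set where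
  field
    project   : Path H (s H) (t H) → Path G (s G) (t G)
    ∈-project : ∀ {q e} → e ∈ₗ edges (project q) → ι e ∈ₗ edges q

module _ {G H : Graph} {ι : Fin (nE G) → Fin (nE H)} where

  serial-transfer : ∀ {img} → Lifting G H ι → IsImage ι img → ∀ {S} → Serial G S → Serial H (img S)
  serial-transfer {img} L im {S} (p , simple , S⊆p) = lift p , lift-simple simple , covered
    where
    open Lifting L
    open IsImage im
    covered : ∀ x → x ∈ img S → x ∈ₗ edges (lift p)
    covered x x∈ with image⁻ x∈
    ... | e , refl , e∈S = ∈-lift⁺ (S⊆p e e∈S)

  lift-reflects-cut-minus : ∀ {C K j} (L : Lifting G H ι) →
    (∀ {p y} → y ∈ₗ edges (Lifting.lift L p) → y ∈ K → ∃ λ e → y ≡ ι e × e ∈ C) →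
    IsCut H (K - ι j) → IsCut G (C - j)
  lift-reflects-cut-minus {C} {K} {j} L covers cut p avoids = cut (lift p) (All.tabulate outside-K-ιj)
    where
    open Lifting L
    outside-K-ιj : ∀ {y} → y ∈ₗ edges (lift p) → y ∉ K - ι j
    outside-K-ιj y∈p y∈K-ιj with covers y∈p (p─q⊆p K ⁅ ι j ⁆ y∈K-ιj)
    ... | e , refl , e∈C =
      All.lookup avoids (∈-lift⁻ y∈p) (x∈p∧x≢y⇒x∈p-y e∈C λ where refl → x∉p-x K (ι e) y∈K-ιj)

  minimal-cut-transfer : ∀ {img C} → Lifting G H ι → IsImage ι img →
                         IsMinimalCut G C → IsCut H (img C) → IsMinimalCut H (img C)
  minimal-cut-transfer {img} {C} L im minimal cut = ¬cut-minus⇒minimal cut removal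
    where
    open IsImage im
    removal : ∀ {x} → x ∈ img C → ¬ IsCut H (img C - x)
    removal x∈ with image⁻ x∈
    ... | j , refl , j∈C = minimal⇒¬cut-minus minimal j∈C ∘ lift-reflects-cut-minus L (λ _ → image⁻)

  cut-transfer : ∀ {img C} → Projection H G ι → IsImage ι img → IsCut G C → IsCut H (img C)
  cut-transfer P im cut q avoids =
    cut (project q) (All.tabulate λ e∈ e∈C → All.lookup avoids (∈-project e∈) (image⁺ e∈C))
    where
    open Projection P
    open IsImage im

  parallel-transfer : ∀ {img} → Lifting G H ι → Projection H G ι → IsImage ι img →
                      ∀ {S} → Parallel G S → Parallel H (img S)
  parallel-transfer {img} L P im (C , minimal , S⊆C) =
    img C , minimal-cut-transfer L im minimal (cut-transfer P im (proj₁ minimal)) , image-⊆ S⊆C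
    where open IsImage im

record Hom (G H : Graph) : Set where
  field
    vmap    : Fin (nV G) → Fin (nV H)
    emap    : Fin (nE G) → Fin (nE H)
    src-hom : ∀ e → src H (emap e) ≡ vmap (src G e)
    tgt-hom : ∀ e → tgt H (emap e) ≡ vmap (tgt G e)
    s-hom   : vmap (s G) ≡ s H
    t-hom   : vmap (t G) ≡ t H

module _ {G H : Graph} (h : Hom G H) where
  open Hom h

  -- Endpoints are prescribed only up to ≡: in apply G o the ends of an old edge are
  -- merely propositionally those it had in G.
  mapPath : ∀ {u v x y} → Path G u v → x ≡ vmap u → y ≡ vmap v → Path H x y
  mapPath []               refl refl = []
  mapPath (_∷_ e {refl} p) refl y≡   = _∷_ (emap e) {src-hom e} (mapPath p (tgt-hom e) y≡)

  edges-mapPath : ∀ {u v x y} (p : Path G u v) (x≡ : x ≡ vmap u) (y≡ : y ≡ vmap v) →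
                  edges (mapPath p x≡ y≡) ≡ map emap (edges p)
  edges-mapPath []               refl refl = refl
  edges-mapPath (_∷_ e {refl} p) refl y≡   = cong (emap e ∷_) (edges-mapPath p (tgt-hom e) y≡)

  vertices-mapPath : ∀ {u v x y} (p : Path G u v) (x≡ : x ≡ vmap u) (y≡ : y ≡ vmap v) →
                     vertices (mapPath p x≡ y≡) ≡ map vmap (vertices p)
  vertices-mapPath []               refl refl = refl
  vertices-mapPath (_∷_ e {refl} p) refl y≡   = cong (_ ∷_) (vertices-mapPath p (tgt-hom e) y≡)

  hom-lifting : Injective _≡_ _≡_ vmap → Injective _≡_ _≡_ emap → Lifting G H emap
  hom-lifting vmap-inj emap-inj = record
    { lift        = lift
    ; lift-simple = λ {p} → subst Unique (sym (vertices-mapPath p _ _)) ∘ Unique.map⁺ vmap-inj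
    ; ∈-lift⁺     = λ {p} → subst (_ ∈ₗ_) (sym (edges-mapPath p _ _)) ∘ ∈-map⁺ emap
    ; ∈-lift⁻     = ∈-lift⁻
    }
    where
    lift : Path G (s G) (t G) → Path H (s H) (t H)
    lift p = mapPath p (sym s-hom) (sym t-hom)
    ∈-lift⁻ : ∀ {p e} → emap e ∈ₗ edges (lift p) → e ∈ₗ edges p
    ∈-lift⁻ {p} e∈ with ∈-map⁻ emap (subst (_ ∈ₗ_) (edges-mapPath p _ _) e∈)
    ... | e′ , e′∈p , eq = subst (_∈ₗ edges p) (sym (emap-inj eq)) e′∈p

record Contraction (H G : Graph) (ι : Fin (nE G) → Fin (nE H)) : Set where
  field
    π        : Fin (nV H) → Fin (nV G)
    classify : ∀ x → (∃ λ e → x ≡ ι e × src G e ≡ π (src H x) × tgt G e ≡ π (tgt H x))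
                     ⊎ π (src H x) ≡ π (tgt H x)
    π-s      : π (s H) ≡ s G
    π-t      : π (t H) ≡ t G

module _ {H G : Graph} {ι : Fin (nE G) → Fin (nE H)} (κ : Contraction H G ι) where
  open Contraction κ

  contract : ∀ {u v x y} → Path H u v → x ≡ π u → y ≡ π v → Path G x y
  contract []               refl refl = []
  contract (_∷_ x {refl} q) refl y≡ with classify x
  ... | inj₁ (e , refl , src≡ , tgt≡) = _∷_ e {src≡} (contract q tgt≡ y≡)
  ... | inj₂ loop                     = contract q loop y≡

  ∈-contract : ∀ {u v x y} (q : Path H u v) (x≡ : x ≡ π u) (y≡ : y ≡ π v) {e} →
               e ∈ₗ edges (contract q x≡ y≡) → ι e ∈ₗ edges q
  ∈-contract []               refl refl ()
  ∈-contract (_∷_ x {refl} q) refl y≡ e∈ with classify x | e∈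
  ... | inj₁ (e , refl , _ , tgt≡) | here refl = here refl
  ... | inj₁ (e , refl , _ , tgt≡) | there e∈q = there (∈-contract q tgt≡ y≡ e∈q)
  ... | inj₂ loop                  | e∈q       = there (∈-contract q loop y≡ e∈q)

  contraction-projection : Projection H G ι
  contraction-projection = record
    { project   = λ q → contract q (sym π-s) (sym π-t)
    ; ∈-project = ∈-contract _ _ _
    }

module Addition (G : Graph) (a b : Fin (nV G)) (b↛a : ¬ Path G b a) where

  H : Graph
  H = apply G (addition a b b↛a)

  new : Fin (nE H)
  new = fromℕ (nE G)

  inclusion : Hom G H
  inclusion = record
    { vmap = id ; emap = inject₁
    ; src-hom = ext-inject₁ (src G) a ; tgt-hom = ext-inject₁ (tgt G) b
    ; s-hom = refl ; t-hom = refl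
    }

  lifting : Lifting G H inject₁
  lifting = hom-lifting inclusion id inject₁-injective

  serial : ∀ {S} → Serial G S → Serial H (S ∷ʳ outside)
  serial = serial-transfer lifting ∷ʳ-image

  src-new : src H new ≡ a
  src-new = ext-fromℕ (src G) a

  tgt-new : tgt H new ≡ b
  tgt-new = ext-fromℕ (tgt G) b

  module _ (C : Subset (nE G)) where

    old-link : ∀ e → inject₁ e ∉ C ∷ʳ outside → Link G C (src H (inject₁ e)) (tgt H (inject₁ e))
    old-link e e∉ = e , e∉ ∘ ∈-∷ʳ⁺ outside , sym (Hom.src-hom inclusion e) , sym (Hom.tgt-hom inclusion e)

    at-new-src : Star (Link G C) (src H new) a
    at-new-src = subst (λ w → Star (Link G C) w a) (sym src-new) ε

    split-at-new : ∀ {u v} (q : Path H u v) → Avoids (C ∷ʳ outside) q →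
                   Star (Link G C) u v ⊎ (new ∈ₗ edges q × Star (Link G C) u a × Star (Link G C) b v)
    split-at-new []               []            = inj₁ ε
    split-at-new (_∷_ x {refl} q) (x∉ ∷ avoids) with view x | split-at-new q avoids
    ... | ‵inject₁ e | inj₁ r                  = inj₁ (old-link e x∉ ◅ r)
    ... | ‵inject₁ e | inj₂ (new∈q , r₁ , r₂) = inj₂ (there new∈q , old-link e x∉ ◅ r₁ , r₂)
    ... | ‵fromℕ     | inj₁ r                  =
      inj₂ (here refl , at-new-src , subst (λ w → Star (Link G C) w _) tgt-new r)
    ... | ‵fromℕ     | inj₂ (_ , _ , r₂)       = inj₂ (here refl , at-new-src , r₂)

  -- C stays a cut of H unless C-avoiding walks s ⇝ a and b ⇝ t exist; then C must absorb the new edge.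
  parallel : ∀ {S} → Parallel G S → Parallel H (S ∷ʳ outside)
  parallel (C , minimal@(cut , _) , S⊆C) with star? (link? G C) (s G) a ×-dec star? (link? G C) b (t G)
  ... | no ¬via-new =
    C ∷ʳ outside , minimal-cut-transfer lifting ∷ʳ-image minimal cut-H , ∷ʳ-⊆ outside S⊆C
    where
    cut-H : IsCut H (C ∷ʳ outside)
    cut-H q avoids with split-at-new C q avoids
    ... | inj₁ r             = uncurry cut (walk-avoiding r)
    ... | inj₂ (_ , via-new) = ¬via-new via-new
  ... | yes (s↝a , b↝t) = C ∷ʳ inside , ¬cut-minus⇒minimal cut-H removal , ∷ʳ-⊆ inside S⊆C
    where
    cut-H : IsCut H (C ∷ʳ inside)
    cut-H q avoids with split-at-new C q (All.map (_∘ ∷ʳ-⊆ inside id) avoids)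
    ... | inj₁ r           = uncurry cut (walk-avoiding r)
    ... | inj₂ (new∈q , _) = All.lookup avoids new∈q (fromℕ∈p∷ʳinside C)

    lift-avoids : ∀ {u v x y} {p : Path G u v} (x≡ : x ≡ u) (y≡ : y ≡ v) → Avoids C p →
                  Avoids (C ∷ʳ inside - new) (mapPath inclusion p x≡ y≡)
    lift-avoids {p = p} x≡ y≡ avoids = subst (All _) (sym (edges-mapPath inclusion p x≡ y≡))
      (map⁺ (All.map (λ e∉C e∈ → e∉C (∈-∷ʳ⁻ inside (p─q⊆p _ _ e∈))) avoids))

    s-to-a : Σ (Path G (s G) a) (Avoids C)
    s-to-a = walk-avoiding s↝a

    b-to-t : Σ (Path G b (t G)) (Avoids C)
    b-to-t = walk-avoiding b↝t

    via-new : Path H (s H) (t H)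
    via-new = mapPath inclusion (proj₁ s-to-a) refl refl
           ++ᵖ _∷_ new {src-new} (mapPath inclusion (proj₁ b-to-t) tgt-new refl)

    via-new-avoids : Avoids (C ∷ʳ inside - new) via-new
    via-new-avoids = subst (All _) (sym (edges-++ᵖ (mapPath inclusion (proj₁ s-to-a) refl refl) _))
      (++⁺ (lift-avoids refl refl (proj₂ s-to-a))
           (x∉p-x (C ∷ʳ inside) new ∷ lift-avoids tgt-new refl (proj₂ b-to-t)))

    covers : ∀ {p y} → y ∈ₗ edges (Lifting.lift lifting p) → y ∈ C ∷ʳ inside →
             ∃ λ e → y ≡ inject₁ e × e ∈ C
    covers {p} y∈p y∈ with ∈-map⁻ inject₁ (subst (_ ∈ₗ_) (edges-mapPath inclusion p refl refl) y∈p)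
    ... | e , _ , refl = e , refl , ∈-∷ʳ⁻ inside y∈

    removal : ∀ {x} → x ∈ C ∷ʳ inside → ¬ IsCut H (C ∷ʳ inside - x)
    removal {x} x∈ with view x
    ... | ‵inject₁ j =
      minimal⇒¬cut-minus minimal (∈-∷ʳ⁻ inside x∈) ∘ lift-reflects-cut-minus lifting covers
    ... | ‵fromℕ     = λ cut-minus-new → cut-minus-new via-new via-new-avoids

module ForwardSplit (G : Graph) (a : Fin (nV G)) (a≢t : a ≢ t G) (M : Subset (nE G))
                    (M-from-a : ∀ e → e ∈ M → src G e ≡ a) (M≢∅ : ∃ λ e → e ∈ M) where

  H : Graph
  H = apply G (fsplit a a≢t M M-from-a M≢∅)

  b : Fin (nV H)
  b = fromℕ (nV G)

  new : Fin (nE H)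
  new = fromℕ (nE G)

  src-new : src H new ≡ inject₁ a
  src-new = ext-fromℕ {nE G} _ (inject₁ a)

  tgt-new : tgt H new ≡ b
  tgt-new = ext-fromℕ {nE G} _ b

  tgt-old : ∀ e → tgt H (inject₁ e) ≡ inject₁ (tgt G e)
  tgt-old = ext-inject₁ _ b

  src-moved : ∀ {e} → e ∈ M → src H (inject₁ e) ≡ b
  src-moved {e} e∈M = trans (ext-inject₁ _ (inject₁ a) e)
                            (cong (λ m → if m then b else inject₁ (src G e)) ([]=⇒lookup e∈M))

  src-kept : ∀ {e} → e ∉ M → src H (inject₁ e) ≡ inject₁ (src G e)
  src-kept {e} e∉M = trans (ext-inject₁ _ (inject₁ a) e)
                           (cong (λ m → if m then b else inject₁ (src G e)) (¬-not (e∉M ∘ lookup⇒[]= e M)))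

  lift : ∀ {u v x y} → Path G u v → x ≡ inject₁ u → y ≡ inject₁ v → Path H x y
  lift []               refl refl = []
  lift (_∷_ e {refl} p) refl y≡ with e ∈? M
  ... | yes e∈M = _∷_ new {trans src-new (cong inject₁ (sym (M-from-a e e∈M)))}
                    (_∷_ (inject₁ e) {trans (src-moved e∈M) (sym tgt-new)} (lift p (tgt-old e) y≡))
  ... | no  e∉M = _∷_ (inject₁ e) {src-kept e∉M} (lift p (tgt-old e) y≡)

  ∈-lift⁺ : ∀ {u v x y} (p : Path G u v) (x≡ : x ≡ inject₁ u) (y≡ : y ≡ inject₁ v) {e} →
            e ∈ₗ edges p → inject₁ e ∈ₗ edges (lift p x≡ y≡)
  ∈-lift⁺ (_∷_ e {refl} p) refl y≡ e′∈ with e ∈? M | e′∈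
  ... | yes _ | here refl = there (here refl)
  ... | no  _ | here refl = here refl
  ... | yes _ | there e′∈p = there (there (∈-lift⁺ p (tgt-old e) y≡ e′∈p))
  ... | no  _ | there e′∈p = there (∈-lift⁺ p (tgt-old e) y≡ e′∈p)

  ∈-lift⁻ : ∀ {u v x y} (p : Path G u v) (x≡ : x ≡ inject₁ u) (y≡ : y ≡ inject₁ v) {e} →
            inject₁ e ∈ₗ edges (lift p x≡ y≡) → e ∈ₗ edges p
  ∈-lift⁻ []               refl refl ()
  ∈-lift⁻ (_∷_ e {refl} p) refl y≡ e′∈ with e ∈? M | e′∈
  ... | yes _ | here eq                = ⊥-elim (fromℕ≢inject₁ (sym eq))
  ... | yes _ | there (here eq)        = here (inject₁-injective eq)
  ... | yes _ | there (there e′∈lift) = there (∈-lift⁻ p (tgt-old e) y≡ e′∈lift)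
  ... | no  _ | here eq                = here (inject₁-injective eq)
  ... | no  _ | there e′∈lift         = there (∈-lift⁻ p (tgt-old e) y≡ e′∈lift)

  Origin : Fin (nV H) → List (Fin (nV G)) → Set
  Origin z ws = (∃ λ w → w ∈ₗ ws × z ≡ inject₁ w) ⊎ (z ≡ b × a ∈ₗ ws)

  origin-there : ∀ {z w ws} → Origin z ws → Origin z (w ∷ ws)
  origin-there = Sum.map (λ (w , w∈ , eq) → w , there w∈ , eq) (λ (eq , a∈) → eq , there a∈)

  ∈-vertices-lift : ∀ {u v x y} (p : Path G u v) (x≡ : x ≡ inject₁ u) (y≡ : y ≡ inject₁ v) {z} →
                    z ∈ₗ vertices (lift p x≡ y≡) → Origin z (vertices p)
  ∈-vertices-lift []               refl refl (here refl) = inj₁ (_ , here refl , refl)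
  ∈-vertices-lift (_∷_ e {refl} p) refl y≡ z∈ with e ∈? M | z∈
  ... | yes _   | here refl         = inj₁ (_ , here refl , refl)
  ... | no  _   | here refl         = inj₁ (_ , here refl , refl)
  ... | yes e∈M | there (here refl) = inj₂ (tgt-new , here (sym (M-from-a e e∈M)))
  ... | yes _   | there (there z∈p) = origin-there (∈-vertices-lift p (tgt-old e) y≡ z∈p)
  ... | no  _   | there z∈p         = origin-there (∈-vertices-lift p (tgt-old e) y≡ z∈p)

  inject₁-∉-lift : ∀ {u v x y} (p : Path G u v) (x≡ : x ≡ inject₁ u) (y≡ : y ≡ inject₁ v) {w} →
                   w ∉ₗ vertices p → inject₁ w ∉ₗ vertices (lift p x≡ y≡)
  inject₁-∉-lift p x≡ y≡ w∉p w∈ with ∈-vertices-lift p x≡ y≡ w∈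
  ... | inj₁ (w′ , w′∈p , eq) = w∉p (subst (_∈ₗ _) (sym (inject₁-injective eq)) w′∈p)
  ... | inj₂ (eq , _)         = fromℕ≢inject₁ (sym eq)

  b-∉-lift : ∀ {u v x y} (p : Path G u v) (x≡ : x ≡ inject₁ u) (y≡ : y ≡ inject₁ v) →
             a ∉ₗ vertices p → b ∉ₗ vertices (lift p x≡ y≡)
  b-∉-lift p x≡ y≡ a∉p b∈ with ∈-vertices-lift p x≡ y≡ b∈
  ... | inj₁ (_ , _ , eq) = fromℕ≢inject₁ eq
  ... | inj₂ (_ , a∈p)    = a∉p a∈p

  lift-simple : ∀ {u v x y} (p : Path G u v) (x≡ : x ≡ inject₁ u) (y≡ : y ≡ inject₁ v) →
                Simple p → Simple (lift p x≡ y≡)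
  lift-simple []               refl refl _ = [] ∷ []
  lift-simple (_∷_ e {refl} p) refl y≡ simple@(_ ∷ simple-p) with e ∈? M
  ... | yes e∈M = Unique-∷ (λ where (here eq) → fromℕ≢inject₁ (trans (sym tgt-new) (sym eq))
                                    (there u∈) → inject₁-∉-lift p _ y≡ (Unique[x∷xs]⇒x∉xs simple) u∈)
                    (Unique-∷ (b-∉-lift p _ y≡ a∉p ∘ subst (_∈ₗ vertices (lift p (tgt-old e) y≡)) tgt-new)
                              (lift-simple p _ y≡ simple-p))
    where
    a∉p : a ∉ₗ vertices p
    a∉p = subst (_∉ₗ vertices p) (M-from-a e e∈M) (Unique[x∷xs]⇒x∉xs simple)
  ... | no _ = Unique-∷ (inject₁-∉-lift p _ y≡ (Unique[x∷xs]⇒x∉xs simple)) (lift-simple p _ y≡ simple-p)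

  lifting : Lifting G H inject₁
  lifting = record
    { lift        = λ p → lift p refl refl
    ; lift-simple = lift-simple _ refl refl
    ; ∈-lift⁺     = ∈-lift⁺ _ refl refl
    ; ∈-lift⁻     = ∈-lift⁻ _ refl refl
    }

  π : Fin (nV H) → Fin (nV G)
  π = ext id a

  π-inject₁ : ∀ v → π (inject₁ v) ≡ v
  π-inject₁ = ext-inject₁ id a

  π-b : π b ≡ a
  π-b = ext-fromℕ id a

  π-src : ∀ e → src G e ≡ π (src H (inject₁ e))
  π-src e with e ∈? M
  ... | yes e∈M = trans (M-from-a e e∈M) (sym (trans (cong π (src-moved e∈M)) π-b))
  ... | no  e∉M = sym (trans (cong π (src-kept e∉M)) (π-inject₁ (src G e)))

  contraction : Contraction H G inject₁
  contraction = record { π = π ; classify = classify ; π-s = π-inject₁ (s G) ; π-t = π-inject₁ (t G) }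
    where
    classify : ∀ x → (∃ λ e → x ≡ inject₁ e × src G e ≡ π (src H x) × tgt G e ≡ π (tgt H x))
                     ⊎ π (src H x) ≡ π (tgt H x)
    classify x with view x
    ... | ‵inject₁ e = inj₁ (e , refl , π-src e , sym (trans (cong π (tgt-old e)) (π-inject₁ (tgt G e))))
    ... | ‵fromℕ     = inj₂ (begin
      π (src H new)  ≡⟨ cong π src-new ⟩
      π (inject₁ a)  ≡⟨ π-inject₁ a ⟩
      a              ≡⟨ π-b ⟨
      π b            ≡⟨ cong π tgt-new ⟨
      π (tgt H new)  ∎)
      where open ≡-Reasoning

  parallel : ∀ {S} → Parallel G S → Parallel H (S ∷ʳ outside)
  parallel = parallel-transfer lifting (contraction-projection contraction) ∷ʳ-image

  serial : ∀ {S} → Serial G S → Serial H (S ∷ʳ outside)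
  serial = serial-transfer lifting ∷ʳ-image

-- A backward split of G is the reverse of a forward split of the reverse of G.
module BackwardSplit (G : Graph) (b : Fin (nV G)) (b≢s : b ≢ s G) (M : Subset (nE G))
                     (M-into-b : ∀ e → e ∈ M → tgt G e ≡ b) (M≢∅ : ∃ λ e → e ∈ M) where

  H : Graph
  H = apply G (bsplit b b≢s M M-into-b M≢∅)

  private
    module F = ForwardSplit (reverseGraph G) b b≢s M M-into-b M≢∅

  parallel : ∀ {S} → Parallel G S → Parallel H (S ∷ʳ outside)
  parallel = parallel-reverse ∘ F.parallel ∘ parallel-reverse

  serial : ∀ {S} → Serial G S → Serial H (S ∷ʳ outside)
  serial = serial-reverse ∘ F.serial ∘ serial-reverse

module Isomorphism {H G : Graph} (I : Iso H G) where
  open Iso I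
  open Inverse φV using () renaming (to to toV; from to fromV)
  open Inverse φE using () renaming (to to toE; from to fromE)

  image : Subset (nE H) → Subset (nE G)
  image S = tabulate (lookup S ∘ fromE)

  isImage : IsImage toE image
  isImage = record
    { image⁺ = λ {S} {e} e∈S → lookup⇒[]= (toE e) (image S) (begin
        lookup (image S) (toE e)  ≡⟨ lookup∘tabulate (lookup S ∘ fromE) (toE e) ⟩
        lookup S (fromE (toE e))  ≡⟨ cong (lookup S) (Inverse.strictlyInverseʳ φE e) ⟩
        lookup S e                ≡⟨ []=⇒lookup e∈S ⟩
        inside                    ∎)
    ; image⁻ = λ {S} {x} x∈ → fromE x , sym (Inverse.strictlyInverseˡ φE x) ,
        lookup⇒[]= (fromE x) S (trans (sym (lookup∘tabulate (lookup S ∘ fromE) x)) ([]=⇒lookup x∈))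
    }
    where open ≡-Reasoning

  toE-injective : Injective _≡_ _≡_ toE
  toE-injective = Injection.injective (↔⇒↣ φE)

  lifting : Lifting H G toE
  lifting = hom-lifting
    (record { vmap = toV ; emap = toE ; src-hom = srcPres ; tgt-hom = tgtPres
            ; s-hom = sPres ; t-hom = tPres })
    (Injection.injective (↔⇒↣ φV)) toE-injective

  inverse-preserves-end : ∀ {endH : Fin (nE H) → Fin (nV H)} {endG : Fin (nE G) → Fin (nV G)} →
                          (∀ e → endG (toE e) ≡ toV (endH e)) → ∀ y → endH (fromE y) ≡ fromV (endG y)
  inverse-preserves-end {endH} {endG} pres y = begin
    endH (fromE y)                ≡⟨ Inverse.strictlyInverseʳ φV _ ⟨
    fromV (toV (endH (fromE y)))  ≡⟨ cong fromV (pres (fromE y)) ⟨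
    fromV (endG (toE (fromE y)))  ≡⟨ cong (fromV ∘ endG) (Inverse.strictlyInverseˡ φE y) ⟩
    fromV (endG y)                ∎
    where open ≡-Reasoning

  contraction : Contraction G H toE
  contraction = record
    { π        = fromV
    ; classify = λ y → inj₁ ( fromE y , sym (Inverse.strictlyInverseˡ φE y)
                            , inverse-preserves-end srcPres y , inverse-preserves-end tgtPres y)
    ; π-s      = trans (cong fromV (sym sPres)) (Inverse.strictlyInverseʳ φV (s H))
    ; π-t      = trans (cong fromV (sym tPres)) (Inverse.strictlyInverseʳ φV (t H))
    }

  parallel : ∀ {S} → Parallel H S → Parallel G (image S)
  parallel = parallel-transfer lifting (contraction-projection contraction) isImage

  serial : ∀ {S} → Serial H S → Serial G (image S)
  serial = serial-transfer lifting isImage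

  ∣image∣ : ∀ S → ∣ S ∣ ≤ ∣ image S ∣
  ∣image∣ S = ∣p∣≤∣q∣-by-injection toE toE-injective (IsImage.image⁺ isImage {S})

parallel-step : ∀ {G S} (o : Op G) → Parallel G S → Parallel (apply G o) (transport (step o done) S)
parallel-step {G} (addition a b b↛a)           = Addition.parallel G a b b↛a
parallel-step {G} (fsplit a a≢t M M-from-a M≢∅) = ForwardSplit.parallel G a a≢t M M-from-a M≢∅
parallel-step {G} (bsplit b b≢s M M-into-b M≢∅) = BackwardSplit.parallel G b b≢s M M-into-b M≢∅

serial-step : ∀ {G S} (o : Op G) → Serial G S → Serial (apply G o) (transport (step o done) S)
serial-step {G} (addition a b b↛a)           = Addition.serial G a b b↛a
serial-step {G} (fsplit a a≢t M M-from-a M≢∅) = ForwardSplit.serial G a a≢t M M-from-a M≢∅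
serial-step {G} (bsplit b b≢s M M-into-b M≢∅) = BackwardSplit.serial G b b≢s M M-into-b M≢∅

transport-preserves : (P : (G : Graph) → Subset (nE G) → Set) →
                      (∀ {G S} (o : Op G) → P G S → P (apply G o) (transport (step o done) S)) →
                      ∀ {G H} (ops : Steps G H) {S} → P G S → P H (transport ops S)
transport-preserves P P-step done                            = id
transport-preserves P P-step (step o@(addition _ _ _) ops)   = transport-preserves P P-step ops ∘ P-step o
transport-preserves P P-step (step o@(fsplit _ _ _ _ _) ops) = transport-preserves P P-step ops ∘ P-step o
transport-preserves P P-step (step o@(bsplit _ _ _ _ _) ops) = transport-preserves P P-step ops ∘ P-step o

∣transport∣ : ∀ {G H} (ops : Steps G H) S → ∣ transport ops S ∣ ≡ ∣ S ∣
∣transport∣ done                          S = refl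
∣transport∣ (step (addition _ _ _) ops)   S = trans (∣transport∣ ops _) (∣p∷ʳoutside∣≡∣p∣ S)
∣transport∣ (step (fsplit _ _ _ _ _) ops) S = trans (∣transport∣ ops _) (∣p∷ʳoutside∣≡∣p∣ S)
∣transport∣ (step (bsplit _ _ _ _ _) ops) S = trans (∣transport∣ ops _) (∣p∷ʳoutside∣≡∣p∣ S)

module _ {G′ G : Graph} where

  embed : DEmbedded G′ G → Subset (nE G′) → Subset (nE G)
  embed (_ , ops , I) S = Isomorphism.image I (transport ops S)

  embed-parallel : ∀ (d : DEmbedded G′ G) {S} → Parallel G′ S → Parallel G (embed d S)
  embed-parallel (_ , ops , I) = Isomorphism.parallel I ∘ transport-preserves Parallel parallel-step ops

  embed-serial : ∀ (d : DEmbedded G′ G) {S} → Serial G′ S → Serial G (embed d S)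
  embed-serial (_ , ops , I) = Isomorphism.serial I ∘ transport-preserves Serial serial-step ops

  ∣embed∣ : ∀ (d : DEmbedded G′ G) S → ∣ S ∣ ≤ ∣ embed d S ∣
  ∣embed∣ (_ , ops , I) S =
    ≤-trans (≤-reflexive (sym (∣transport∣ ops S))) (Isomorphism.∣image∣ I (transport ops S))

  PW-monotone : DEmbedded G′ G → ∀ k k′ → IsPW G k → IsPW G′ k′ → k′ ≤ k
  PW-monotone d k k′ (_ , maximal) ((S , par , refl) , _) =
    ≤-trans (∣embed∣ d S) (maximal _ (embed-parallel d par))

  SPW-monotone : DEmbedded G′ G → ∀ k k′ → IsSPW G k → IsSPW G′ k′ → k′ ≤ k
  SPW-monotone d k k′ (_ , maximal) ((S , ser , par , refl) , _) =
    ≤-trans (∣embed∣ d S) (maximal _ (embed-serial d ser) (embed-parallel d par))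

lemma20 : (G' : Graph) → TwoTerminal G' →
          ((∀ {G} (ops : Steps G' G) (S : Subset (nE G')) →
              (Parallel G' S → Parallel G (transport ops S))
              × (Serial G' S → Serial G (transport ops S)))
          × (∀ G → DEmbedded G' G → ∀ k k' → IsPW G k → IsPW G' k' → k' ≤ k)
          × (∀ G → DEmbedded G' G → ∀ k k' → IsSPW G k → IsSPW G' k' → k' ≤ k))
lemma20 G' _ =
  (λ ops S → transport-preserves Parallel parallel-step ops , transport-preserves Serial serial-step ops)
  , (λ _ → PW-monotone) , (λ _ → SPW-monotone)
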